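{- There exists a $\mathsf{TOTO}$ sentence $\phi_{\mathrm{simple}}$ such that for every permutation $\sigma$, $\sigma\models\phi_{\mathrm{simple}}$ if and only if $\sigma$ is simple.
   Context: A permutation $\sigma$ of size $n$ is identified with the finite structure whose domain is $A^\sigma=\{(i,\sigma(i)) : 1\le i\le n\}$, equipped with two strict total orders: the position order $<_P$ (comparing first coordinates) and the value order $<_V$ (comparing second coordinates). $\mathsf{TOTO}$ is first-order logic (with equality) over the signature consisting of two binary relation symbols $<_P$ and $<_V$, interpreted in this way. An interval of $\sigma$ is a set of consecutive positions $\{i,i+1,\dots,j\}$ whose image under $\sigma$ is also a set of consecutive integers; it is non-trivial if it has at least $2$ and at most $n-1$ elements. A permutation is simple if it has no non-trivial interval (equivalently, it cannot be obtained as a non-trivial inflation). -}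

module Defs where

open import Data.Nat using (ℕ; suc; _+_; _∸_; _≤_; _<_)
open import Data.Fin using (Fin; toℕ)
open import Data.Fin.Permutation using (Permutation′; _⟨$⟩ʳ_)
open import Data.Product using (Σ; _×_)
open import Data.Sum using (_⊎_)
open import Data.Empty using (⊥)
open import Relation.Nullary using (¬_)
open import Relation.Binary.PropositionalEquality using (_≡_)
open import Function.Bundles using (_⇔_)

-- Permutations of size n: bijections of Fin n (positions / values 0..n-1,
-- i.e. the usual 1..n shifted by one).

Perm : ℕ → Set
Perm n = Permutation′ n

-- First-order logic with equality over the signature {<P , <V}.
-- Formulas with k free variables (de Bruijn: variable 'zero' is the most
-- recently bound one).

data Formula : ℕ → Set where
  _≐_   : ∀ {k} → Fin k → Fin k → Formula k
  _<P_  : ∀ {k} → Fin k → Fin k → Formula k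
  _<V_  : ∀ {k} → Fin k → Fin k → Formula k
  ⊥f    : ∀ {k} → Formula k
  ¬f_   : ∀ {k} → Formula k → Formula k
  _∧f_  : ∀ {k} → Formula k → Formula k → Formula k
  _∨f_  : ∀ {k} → Formula k → Formula k → Formula k
  _⇒f_  : ∀ {k} → Formula k → Formula k → Formula k
  ∃f_   : ∀ {k} → Formula (suc k) → Formula k
  ∀f_   : ∀ {k} → Formula (suc k) → Formula k

Sentence : Set
Sentence = Formula 0

-- The structure associated with σ: domain A^σ = {(i, σ(i))}, identified with
-- the position i : Fin n (the map i ↦ (i, σ i) is a bijection onto A^σ).
-- (i,σ i) <P (j,σ j) iff i < j ;  (i,σ i) <V (j,σ j) iff σ i < σ j.

extend : ∀ {k n} → Fin n → (Fin k → Fin n) → Fin (suc k) → Fin n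
extend a ρ Fin.zero    = a
extend a ρ (Fin.suc x) = ρ x

Sat : ∀ {n k} → Perm n → Formula k → (Fin k → Fin n) → Set
Sat σ (x ≐ y)  ρ = ρ x ≡ ρ y
Sat σ (x <P y) ρ = toℕ (ρ x) < toℕ (ρ y)
Sat σ (x <V y) ρ = toℕ (σ ⟨$⟩ʳ ρ x) < toℕ (σ ⟨$⟩ʳ ρ y)
Sat σ ⊥f       ρ = ⊥
Sat σ (¬f φ)   ρ = ¬ Sat σ φ ρ
Sat σ (φ ∧f ψ) ρ = Sat σ φ ρ × Sat σ ψ ρ
Sat σ (φ ∨f ψ) ρ = Sat σ φ ρ ⊎ Sat σ ψ ρ
Sat σ (φ ⇒f ψ) ρ = Sat σ φ ρ → Sat σ ψ ρ
Sat σ (∃f φ)   ρ = Σ (Fin _) λ a → Sat σ φ (extend a ρ)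
Sat σ (∀f φ)   ρ = (a : Fin _) → Sat σ φ (extend a ρ)

noVars : ∀ {n} → Fin 0 → Fin n
noVars ()

_⊨_ : ∀ {n} → Perm n → Sentence → Set
σ ⊨ φ = Sat σ φ noVars

IsInterval : ∀ {n} → Perm n → Fin n → Fin n → Set
IsInterval {n} σ i j =
  (toℕ i ≤ toℕ j) ×
  Σ ℕ λ a → Σ ℕ λ b → (a ≤ b) ×
    ((v : ℕ) →
      (Σ (Fin n) (λ p → (toℕ i ≤ toℕ p) × (toℕ p ≤ toℕ j) × (toℕ (σ ⟨$⟩ʳ p) ≡ v)))
      ⇔ ((a ≤ v) × (v ≤ b)))

-- Number of elements of {i,...,j} is j - i + 1.
NonTrivialInterval : ∀ {n} → Perm n → Fin n → Fin n → Set
NonTrivialInterval {n} σ i j =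
  IsInterval σ i j × (2 ≤ suc (toℕ j ∸ toℕ i)) × (suc (toℕ j ∸ toℕ i) ≤ n ∸ 1)

Simple : ∀ {n} → Perm n → Set
Simple {n} σ = ¬ (Σ (Fin n) λ i → Σ (Fin n) λ j → NonTrivialInterval σ i j)

-- A block [i, j] of positions (i < j) is a non-trivial interval iff some
-- position lies outside it (the block has at most n - 1 elements) and no
-- outside position has a value strictly between the values of two positions
-- inside it. Both conditions only compare positions and values, so the
-- existence of such a block is a TOTO sentence. The gap condition implies the
-- interval property because every value between the least and the greatest
-- value of the block has a preimage, which cannot lie outside the block.

module Submission where

open import Defs
open import Data.Nat using (ℕ; zero; suc; _∸_; _≤_; _<_; _≤?_; s≤s; s≤s⁻¹; z≤n; z<s)
open import Data.Nat.Properties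
open import Data.Product using (Σ; _×_; _,_; proj₁; proj₂)
open import Data.Sum using (_⊎_; inj₁; inj₂)
open import Data.Fin using (Fin; toℕ; #_; fromℕ<)
open import Data.Fin.Properties using (toℕ-injective; toℕ<n; toℕ-fromℕ<)
open import Data.Fin.Permutation using (_⟨$⟩ʳ_; _⟨$⟩ˡ_; inverseʳ)
open import Data.List using (List; filter; allFin)
open import Data.List.Membership.Propositional using (_∈_)
open import Data.List.Membership.Propositional.Properties using (∈-filter⁺; ∈-allFin)
open import Data.List.Relation.Unary.All using (lookup)
open import Data.List.Relation.Unary.All.Properties using (all-filter)
open import Relation.Nullary using (¬_; Dec; yes; no; contradiction)
open import Relation.Nullary.Decidable using (_×-dec_)
open import Relation.Binary.PropositionalEquality using (_≡_; refl; sym; trans; cong; subst; ≢-sym)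
open import Function using (_∘_)
open import Function.Bundles using (_⇔_; mk⇔; Equivalence; Injection)
open import Function.Properties.Inverse using (↔⇒↣)
import Data.List.Extrema

open Data.List.Extrema ≤-totalOrder
open Equivalence using (to; from)

insideF : ∀ {k} → Fin k → Fin k → Fin k → Formula k
insideF x i j = (¬f (x <P i)) ∧f (¬f (j <P x))

outsideF : ∀ {k} → Fin k → Fin k → Fin k → Formula k
outsideF x i j = (x <P i) ∨f (j <P x)

-- The block is [i, j] with i = # 1 and j = # 0.
nonTrivialIntervalF : Formula 2
nonTrivialIntervalF =
  ((# 1) <P (# 0)) ∧f ((∃f outsideF (# 0) (# 2) (# 1)) ∧f
  (∀f (outsideF (# 0) (# 2) (# 1) ⇒f
         (¬f (∃f (∃f (insideF (# 1) (# 4) (# 3) ∧f (insideF (# 0) (# 4) (# 3) ∧f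
                     (((# 1) <V (# 2)) ∧f ((# 2) <V (# 0)))))))))))

simpleF : Sentence
simpleF = ¬f (∃f (∃f nonTrivialIntervalF))

2≤1+[n∸m]⇔m<n : ∀ {m n} → 2 ≤ suc (n ∸ m) ⇔ m < n
2≤1+[n∸m]⇔m<n = mk⇔ (λ { (s≤s 0<n∸m) → m∸n≢0⇒n<m (≢-sym (<⇒≢ 0<n∸m)) })
                     (s≤s ∘ m<n⇒0<n∸m)

1+[n∸m]≤o∸1⇔0<m⊎1+n<o : ∀ {m n o} → m ≤ n → n < o →
                         suc (n ∸ m) ≤ o ∸ 1 ⇔ (0 < m ⊎ suc n < o)
1+[n∸m]≤o∸1⇔0<m⊎1+n<o m≤n n<o = mk⇔ short⇒ (⇒short m≤n n<o)
  where
  short⇒ : ∀ {m n o} → suc (n ∸ m) ≤ o ∸ 1 → 0 < m ⊎ suc n < o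
  short⇒ {zero}  {o = suc o} 1+n≤o = inj₂ (s≤s 1+n≤o)
  short⇒ {suc m}             _     = inj₁ z<s

  ⇒short : ∀ {m n o} → m ≤ n → n < o → 0 < m ⊎ suc n < o → suc (n ∸ m) ≤ o ∸ 1
  ⇒short {suc m} {suc n} {suc o} _ n<o (inj₁ _) = ≤-trans (s≤s (m∸n≤m n m)) (s≤s⁻¹ n<o)
  ⇒short {m} {n} {suc o} _ _ (inj₂ 1+n<o) = ≤-trans (s≤s (m∸n≤m n m)) (s≤s⁻¹ 1+n<o)

module _ {n : ℕ} (σ : Perm n) where

  value : Fin n → ℕ
  value p = toℕ (σ ⟨$⟩ʳ p)

  value-injective : ∀ {p q} → value p ≡ value q → p ≡ q
  value-injective = Injection.injective (↔⇒↣ σ) ∘ toℕ-injective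

  preimage : ∀ {v} → v < n → Σ (Fin n) λ p → value p ≡ v
  preimage v<n = σ ⟨$⟩ˡ fromℕ< v<n , trans (cong toℕ (inverseʳ σ)) (toℕ-fromℕ< v<n)

  module _ (i j : Fin n) where

    InBlock : Fin n → Set
    InBlock p = toℕ i ≤ toℕ p × toℕ p ≤ toℕ j

    inBlock? : ∀ p → Dec (InBlock p)
    inBlock? p = (toℕ i ≤? toℕ p) ×-dec (toℕ p ≤? toℕ j)

    -- InBlock as the formula insideF expresses it.
    Inside : Fin n → Set
    Inside p = ¬ toℕ p < toℕ i × ¬ toℕ j < toℕ p

    Outside : Fin n → Set
    Outside p = toℕ p < toℕ i ⊎ toℕ j < toℕ p

    Splits : Fin n → Set
    Splits z = Σ (Fin n) λ q → Σ (Fin n) λ r →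
      Inside q × Inside r × value q < value z × value z < value r

    GapFree : Set
    GapFree = ∀ z → Outside z → ¬ Splits z

    inside⇒inBlock : ∀ {p} → Inside p → InBlock p
    inside⇒inBlock (p≮i , j≮p) = ≮⇒≥ p≮i , ≮⇒≥ j≮p

    inBlock⇒inside : ∀ {p} → InBlock p → Inside p
    inBlock⇒inside (i≤p , p≤j) = ≤⇒≯ i≤p , ≤⇒≯ p≤j

    outside⇒¬inBlock : ∀ {p} → Outside p → ¬ InBlock p
    outside⇒¬inBlock (inj₁ p<i) (i≤p , _) = <⇒≱ p<i i≤p
    outside⇒¬inBlock (inj₂ j<p) (_ , p≤j) = <⇒≱ j<p p≤j

    ¬inBlock⇒outside : ∀ {p} → ¬ InBlock p → Outside p
    ¬inBlock⇒outside {p} ¬in with toℕ i ≤? toℕ p | toℕ p ≤? toℕ j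
    ... | no  i≰p | _        = inj₁ (≰⇒> i≰p)
    ... | yes _   | no  p≰j = inj₂ (≰⇒> p≰j)
    ... | yes i≤p | yes p≤j = contradiction (i≤p , p≤j) ¬in

    ∃outside⇔0<i⊎1+j<n : Σ (Fin n) Outside ⇔ (0 < toℕ i ⊎ suc (toℕ j) < n)
    ∃outside⇔0<i⊎1+j<n = mk⇔ witness⇒ ⇒witness
      where
      witness⇒ : Σ (Fin n) Outside → 0 < toℕ i ⊎ suc (toℕ j) < n
      witness⇒ (z , inj₁ z<i) = inj₁ (≤-<-trans z≤n z<i)
      witness⇒ (z , inj₂ j<z) = inj₂ (≤-<-trans j<z (toℕ<n z))

      ⇒witness : 0 < toℕ i ⊎ suc (toℕ j) < n → Σ (Fin n) Outside
      ⇒witness (inj₁ 0<i) =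
        fromℕ< 0<n , inj₁ (subst (_< toℕ i) (sym (toℕ-fromℕ< 0<n)) 0<i)
        where 0<n = <-trans 0<i (toℕ<n i)
      ⇒witness (inj₂ 1+j<n) =
        fromℕ< 1+j<n , inj₂ (subst (toℕ j <_) (sym (toℕ-fromℕ< 1+j<n)) ≤-refl)

    ImageOfBlock : ℕ → Set
    ImageOfBlock v = Σ (Fin n) λ p → toℕ i ≤ toℕ p × toℕ p ≤ toℕ j × value p ≡ v

    imageOfBlock : ∀ {p v} → InBlock p → value p ≡ v → ImageOfBlock v
    imageOfBlock {p} (i≤p , p≤j) vp≡v = p , i≤p , p≤j , vp≡v

    isInterval⇒gapFree : IsInterval σ i j → GapFree
    isInterval⇒gapFree (_ , a , b , _ , image) z z-out (q , r , q-in , r-in , q<z , z<r)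
      with from (image (value z)) (≤-trans a≤q (<⇒≤ q<z) , ≤-trans (<⇒≤ z<r) r≤b)
      where
      inImage : ∀ {p} → Inside p → ImageOfBlock (value p)
      inImage p-in = imageOfBlock (inside⇒inBlock p-in) refl
      a≤q = proj₁ (to (image (value q)) (inImage q-in))
      r≤b = proj₂ (to (image (value r)) (inImage r-in))
    ... | p , i≤p , p≤j , vp≡vz =
      outside⇒¬inBlock z-out (subst InBlock (value-injective vp≡vz) (i≤p , p≤j))

    block : List (Fin n)
    block = filter inBlock? (allFin n)

    lowest : Fin n
    lowest = argmin value i block

    highest : Fin n
    highest = argmax value i block

    ∈-block : ∀ {p} → InBlock p → p ∈ block
    ∈-block p-in = ∈-filter⁺ inBlock? (∈-allFin _) p-in

    lowest-inBlock : InBlock i → InBlock lowest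
    lowest-inBlock i-in = argmin-all value i-in (all-filter inBlock? (allFin n))

    highest-inBlock : InBlock i → InBlock highest
    highest-inBlock i-in = argmax-all value i-in (all-filter inBlock? (allFin n))

    lowest-least : ∀ {p} → InBlock p → value lowest ≤ value p
    lowest-least p-in = lookup (f[argmin]≤f[xs] i block) (∈-block p-in)

    highest-greatest : ∀ {p} → InBlock p → value p ≤ value highest
    highest-greatest p-in = lookup (f[xs]≤f[argmax] i block) (∈-block p-in)

    gapFree⇒covered : GapFree → InBlock i → ∀ {v} →
                      value lowest < v → v < value highest → ImageOfBlock v
    gapFree⇒covered gap i-in {v} lo<v v<hi
      with preimage (<-trans v<hi (toℕ<n (σ ⟨$⟩ʳ highest)))
    ... | z , vz≡v with inBlock? z
    ...   | yes z-in = imageOfBlock z-in vz≡v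
    ...   | no  z∉   = contradiction
      (lowest , highest , inBlock⇒inside (lowest-inBlock i-in) , inBlock⇒inside (highest-inBlock i-in)
      , subst (value lowest <_) (sym vz≡v) lo<v , subst (_< value highest) (sym vz≡v) v<hi)
      (gap z (¬inBlock⇒outside z∉))

    gapFree⇒isInterval : toℕ i ≤ toℕ j → GapFree → IsInterval σ i j
    gapFree⇒isInterval i≤j gap =
      i≤j , value lowest , value highest , lowest-least (highest-inBlock i-in) ,
      λ v → mk⇔ bounded covered
      where
      i-in : InBlock i
      i-in = ≤-refl , i≤j

      bounded : ∀ {v} → ImageOfBlock v → value lowest ≤ v × v ≤ value highest
      bounded (p , i≤p , p≤j , refl) = lowest-least (i≤p , p≤j) , highest-greatest (i≤p , p≤j)

      covered : ∀ {v} → value lowest ≤ v × v ≤ value highest → ImageOfBlock v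
      covered (lo≤v , v≤hi) with m≤n⇒m<n∨m≡n lo≤v | m≤n⇒m<n∨m≡n v≤hi
      ... | inj₂ lo≡v | _         = imageOfBlock (lowest-inBlock i-in) lo≡v
      ... | inj₁ _    | inj₂ v≡hi = imageOfBlock (highest-inBlock i-in) (sym v≡hi)
      ... | inj₁ lo<v | inj₁ v<hi = gapFree⇒covered gap i-in lo<v v<hi

    nonTrivialInterval⇔sat : NonTrivialInterval σ i j ⇔
                             Sat σ nonTrivialIntervalF (extend j (extend i noVars))
    nonTrivialInterval⇔sat = mk⇔ ⇒sat sat⇒
      where
      length⇔ : toℕ i ≤ toℕ j → suc (toℕ j ∸ toℕ i) ≤ n ∸ 1 ⇔ (0 < toℕ i ⊎ suc (toℕ j) < n)
      length⇔ i≤j = 1+[n∸m]≤o∸1⇔0<m⊎1+n<o i≤j (toℕ<n j)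

      ⇒sat : NonTrivialInterval σ i j → toℕ i < toℕ j × Σ (Fin n) Outside × GapFree
      ⇒sat (interval@(i≤j , _) , 2≤length , short) =
        to 2≤1+[n∸m]⇔m<n 2≤length ,
        from ∃outside⇔0<i⊎1+j<n (to (length⇔ i≤j) short) ,
        isInterval⇒gapFree interval

      sat⇒ : toℕ i < toℕ j × Σ (Fin n) Outside × GapFree → NonTrivialInterval σ i j
      sat⇒ (i<j , outside , gap) =
        gapFree⇒isInterval (<⇒≤ i<j) gap ,
        from 2≤1+[n∸m]⇔m<n i<j ,
        from (length⇔ (<⇒≤ i<j)) (to ∃outside⇔0<i⊎1+j<n outside)

proposition3p12 : Σ Sentence λ φsimple → (n : ℕ) → (σ : Perm n) → (σ ⊨ φsimple) ⇔ Simple σ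
proposition3p12 = simpleF , λ n σ → mk⇔
  (λ sat (i , j , nti) → sat (i , j , to (nonTrivialInterval⇔sat σ i j) nti))
  (λ simple (i , j , s) → simple (i , j , from (nonTrivialInterval⇔sat σ i j) s))
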